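{- Let $r\ge 0$ be an integer and $y,x_1,\ldots,x_r$ indeterminates. Then \[ \prod_{i=1}^r (y+x_i-i+1)=\sum_{i=0}^r (y)_i\sum_{U\in P(r,r-i)}x(U). \]
   Context: $(y)_i=y(y-1)\cdots(y-i+1)$ is the falling factorial. $P(r,k)$ is the set of $k$-element subsets of $[r]=\{1,\ldots,r\}$. For $U\in P(r,k)$ with elements listed in increasing order $U(1)<U(2)<\cdots<U(k)$, $x(U)=\prod_{i=1}^k\bigl(x_{U(i)}-i+1\bigr)$ (so $x(\emptyset)=1$). -}

module Defs where

open import Level using (Level)
open import Data.Nat using (ℕ; zero; suc)
open import Data.Fin using (Fin; zero; suc; toℕ)
open import Data.List using (List; []; _∷_; map; _++_; foldr; upTo; allFin)
open import Algebra.Bundles using (CommutativeRing)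

-- P r k : the k-element subsets of [r] = Fin r, each listed as the list
-- of its elements in increasing order U(1) < ... < U(k).
-- (Fin r = {0,...,r-1} plays the role of {1,...,r}.)
P : (r k : ℕ) → List (List (Fin r))
P zero    zero    = [] ∷ []
P zero    (suc k) = []
P (suc r) zero    = [] ∷ []
P (suc r) (suc k) =
  map (map suc) (P r (suc k)) ++ map (λ U → zero ∷ map suc U) (P r k)

module Ops {c ℓ : Level} (R : CommutativeRing c ℓ) where
  open CommutativeRing R

  nat : ℕ → Carrier
  nat zero    = 0#
  nat (suc n) = 1# + nat n

  prodL : List Carrier → Carrier
  prodL = foldr _*_ 1#

  sumL : List Carrier → Carrier
  sumL = foldr _+_ 0#

  fall : Carrier → ℕ → Carrier
  fall y i = prodL (map (λ j → y - nat j) (upTo i))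

  xFrom : ∀ {r} → (Fin r → Carrier) → ℕ → List (Fin r) → Carrier
  xFrom x k []       = 1#
  xFrom x k (u ∷ us) = (x u - nat k) * xFrom x (suc k) us

  xU : ∀ {r} → (Fin r → Carrier) → List (Fin r) → Carrier
  xU x U = xFrom x 0 U

  -- ∏_{i=1}^r (y + x_i - i + 1)   (index i ∈ Fin r corresponds to i+1)
  lhs : ∀ r → Carrier → (Fin r → Carrier) → Carrier
  lhs r y x = prodL (map (λ i → (y + x i) - nat (toℕ i)) (allFin r))

  rhs : ∀ r → Carrier → (Fin r → Carrier) → Carrier
  rhs r y x = sumL (map (λ i → fall y i * sumL (map (xU x) (P r (r Data.Nat.∸ i)))) (upTo (suc r)))

-- Expand the product one factor at a time, deciding for each position j whether
-- the factor y + x_j - j contributes its "y" part or its "x" part.  If a of the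
-- earlier positions went to y and b to x, then j = a + b and the factor splits as
-- (y - a) + (x_j - b): the y-choices build (y)_i and the x-choices build x(U).
-- Peeling off the first factor thus calls for the statement with all x-offsets
-- raised by b and, on the y-branch, with y replaced by y - 1.  In that generality
-- it follows by induction on r, the right-hand side obeying the same recursion
-- because P(r+1,k+1) splits into the subsets avoiding 0 and those containing it.
module Submission where

open import Defs
open import Level using (Level)
open import Data.Nat using (ℕ; zero; suc; _∸_; _<_; s≤s) renaming (_+_ to _+ℕ_)
open import Data.Nat.Properties using (m<n⇒m<1+n; ≤-refl; +-suc) renaming (+-identityʳ to +ℕ-identityʳ)
open import Data.Fin using (Fin; zero; suc; toℕ)
open import Data.List using (List; []; _∷_; map; _++_; foldr; upTo; applyUpTo; tabulate; allFin)
open import Data.List.Properties using (map-++; map-∘; map-cong; map-applyUpTo; map-upTo; map-tabulate)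
open import Function using (_∘_; id)
open import Algebra.Bundles using (Monoid; CommutativeRing)
import Algebra.Properties.CommutativeSemigroup as CommutativeSemigroupProperties
import Algebra.Properties.Ring as RingProperties
open import Relation.Binary.PropositionalEquality as ≡ using (_≡_; cong)

module FoldrProperties {c ℓ : Level} (M : Monoid c ℓ) where
  open Monoid M

  foldr-++ : ∀ xs ys → foldr _∙_ ε (xs ++ ys) ≈ foldr _∙_ ε xs ∙ foldr _∙_ ε ys
  foldr-++ []       ys = sym (identityˡ _)
  foldr-++ (x ∷ xs) ys = trans (∙-congˡ (foldr-++ xs ys)) (sym (assoc _ _ _))

  foldr-map-cong : ∀ {A : Set} {f g : A → Carrier} → (∀ a → f a ≈ g a) →
                   ∀ xs → foldr _∙_ ε (map f xs) ≈ foldr _∙_ ε (map g xs)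
  foldr-map-cong f≈g []       = refl
  foldr-map-cong f≈g (x ∷ xs) = ∙-cong (f≈g x) (foldr-map-cong f≈g xs)

  foldr-tabulate-cong : ∀ {n} {f g : Fin n → Carrier} → (∀ i → f i ≈ g i) →
                        foldr _∙_ ε (tabulate f) ≈ foldr _∙_ ε (tabulate g)
  foldr-tabulate-cong {zero}  f≈g = refl
  foldr-tabulate-cong {suc n} f≈g = ∙-cong (f≈g zero) (foldr-tabulate-cong (f≈g ∘ suc))

P-empty : ∀ {r k} → r < k → P r k ≡ []
P-empty {zero}  {suc k} _ = ≡.refl
P-empty {suc r} {suc k} (s≤s r<k)
  rewrite P-empty {r} {suc k} (m<n⇒m<1+n r<k) | P-empty r<k = ≡.refl

P-zero : ∀ r → P r 0 ≡ [] ∷ []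
P-zero zero    = ≡.refl
P-zero (suc r) = ≡.refl

module Expansion {c ℓ : Level} (R : CommutativeRing c ℓ) where
  open CommutativeRing R renaming (Carrier to C) hiding (zero)
  open Ops R
  open RingProperties ring using (-‿+-comm; -0#≈0#)
  open CommutativeSemigroupProperties +-commutativeSemigroup using (interchange)
  open CommutativeSemigroupProperties *-commutativeSemigroup using (x∙yz≈y∙xz)
  open FoldrProperties +-monoid renaming (foldr-++ to sumL-++; foldr-map-cong to sumL-map-cong)
  open FoldrProperties *-monoid using () renaming (foldr-map-cong to prodL-map-cong; foldr-tabulate-cong to prodL-tabulate-cong)
  open import Relation.Binary.Reasoning.Setoid setoid

  sumL-map-+ : ∀ {A : Set} (f g : A → C) xs →
               sumL (map (λ a → f a + g a) xs) ≈ sumL (map f xs) + sumL (map g xs)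
  sumL-map-+ f g []       = sym (+-identityʳ 0#)
  sumL-map-+ f g (x ∷ xs) = trans (+-congˡ (sumL-map-+ f g xs)) (interchange _ _ _ _)

  sumL-map-*ˡ : ∀ {A : Set} (a : C) (f : A → C) xs →
                sumL (map (λ u → a * f u) xs) ≈ a * sumL (map f xs)
  sumL-map-*ˡ a f []       = sym (zeroʳ a)
  sumL-map-*ˡ a f (x ∷ xs) = trans (+-congˡ (sumL-map-*ˡ a f xs)) (sym (distribˡ a _ _))

  -- The n-th coefficient of the product of the power series ∑ f i tⁱ and ∑ g k tᵏ;
  -- `rhs` is this coefficient for f = fall y.
  conv : (ℕ → C) → (ℕ → C) → ℕ → C
  conv f g n = sumL (map (λ i → f i * g (n ∸ i)) (upTo (suc n)))

  conv-suc : ∀ f g n → conv f g (suc n) ≡ f 0 * g (suc n) + conv (f ∘ suc) g n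
  conv-suc f g n = cong (f 0 * g (suc n) +_) (≡.trans
    (cong sumL (map-applyUpTo suc (λ i → f i * g (suc n ∸ i)) (suc n)))
    (cong sumL (≡.sym (map-upTo (λ i → f (suc i) * g (n ∸ i)) (suc n)))))

  conv-cong : ∀ {f f′ g g′} → (∀ i → f i ≈ f′ i) → (∀ k → g k ≈ g′ k) →
              ∀ n → conv f g n ≈ conv f′ g′ n
  conv-cong f≈ g≈ n = sumL-map-cong (λ i → *-cong (f≈ i) (g≈ (n ∸ i))) (upTo (suc n))

  conv-+ʳ : ∀ f g h n → conv f (λ k → g k + h k) n ≈ conv f g n + conv f h n
  conv-+ʳ f g h n = trans (sumL-map-cong (λ i → distribˡ (f i) _ _) (upTo (suc n)))
                          (sumL-map-+ _ _ (upTo (suc n)))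

  conv-*ˡ : ∀ a f g n → conv (λ i → a * f i) g n ≈ a * conv f g n
  conv-*ˡ a f g n = trans (sumL-map-cong (λ i → *-assoc a (f i) _) (upTo (suc n)))
                          (sumL-map-*ˡ a _ (upTo (suc n)))

  conv-*ʳ : ∀ a f g n → conv f (λ k → a * g k) n ≈ a * conv f g n
  conv-*ʳ a f g n = trans (sumL-map-cong (λ i → x∙yz≈y∙xz (f i) a _) (upTo (suc n)))
                          (sumL-map-*ˡ a _ (upTo (suc n)))

  shift : (ℕ → C) → ℕ → C
  shift g zero    = 0#
  shift g (suc k) = g k

  conv-shift : ∀ f g n → conv f (shift g) (suc n) ≈ conv f g n
  conv-shift f g zero = +-congˡ (trans (+-congʳ (zeroʳ (f 1))) (+-identityʳ 0#))
  conv-shift f g (suc n) = begin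
    conv f (shift g) (suc (suc n))             ≡⟨ conv-suc f (shift g) (suc n) ⟩
    f 0 * g (suc n) + conv (f ∘ suc) (shift g) (suc n) ≈⟨ +-congˡ (conv-shift (f ∘ suc) g n) ⟩
    f 0 * g (suc n) + conv (f ∘ suc) g n       ≡⟨ ≡.sym (conv-suc f g n) ⟩
    conv f g (suc n)                           ∎

  minus-suc : ∀ a n → a - nat (suc n) ≈ (a - 1#) - nat n
  minus-suc a n = trans (+-congˡ (sym (-‿+-comm 1# (nat n)))) (sym (+-assoc a _ _))

  fall-suc : ∀ y i → fall y (suc i) ≈ y * fall (y - 1#) i
  fall-suc y i = begin
    (y - 0#) * prodL (map (λ j → y - nat j) (applyUpTo suc i))
      ≡⟨ cong (λ l → (y - 0#) * prodL l)
              (≡.trans (map-applyUpTo suc _ i) (≡.sym (map-upTo (λ j → y - nat (suc j)) i))) ⟩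
    (y - 0#) * prodL (map (λ j → y - nat (suc j)) (upTo i))
      ≈⟨ *-cong (trans (+-congˡ -0#≈0#) (+-identityʳ y)) (prodL-map-cong (minus-suc y) (upTo i)) ⟩
    y * fall (y - 1#) i ∎

  subsetSum : ∀ {r} → ℕ → (Fin r → C) → ℕ → C
  subsetSum {r} b x k = sumL (map (xFrom x b) (P r k))

  xFrom-map : ∀ {r s} (x : Fin s → C) (g : Fin r → Fin s) b U →
              xFrom x b (map g U) ≡ xFrom (x ∘ g) b U
  xFrom-map x g b []       = ≡.refl
  xFrom-map x g b (u ∷ U) = cong ((x (g u) - nat b) *_) (xFrom-map x g (suc b) U)

  subsetSum-zero : ∀ {r} b (x : Fin r → C) → subsetSum b x 0 ≈ 1#
  subsetSum-zero {r} b x rewrite P-zero r = +-identityʳ 1#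

  subsetSum-empty : ∀ {r} b (x : Fin r → C) → subsetSum b x (suc r) ≈ 0#
  subsetSum-empty {r} b x rewrite P-empty {r} {suc r} ≤-refl = refl

  subsetSum-split : ∀ {r} b (x : Fin (suc r) → C) k →
    subsetSum b x k ≈ subsetSum b (x ∘ suc) k + (x zero - nat b) * shift (subsetSum (suc b) (x ∘ suc)) k
  subsetSum-split b x zero = begin
    subsetSum b x 0                                   ≈⟨ subsetSum-zero b x ⟩
    1#                                                ≈⟨ sym (subsetSum-zero b (x ∘ suc)) ⟩
    subsetSum b (x ∘ suc) 0                           ≈⟨ sym (+-identityʳ _) ⟩
    subsetSum b (x ∘ suc) 0 + 0#                      ≈⟨ +-congˡ (sym (zeroʳ _)) ⟩
    subsetSum b (x ∘ suc) 0 + (x zero - nat b) * 0#   ∎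
  subsetSum-split {r} b x (suc k) = begin
    sumL (map xb (map (map suc) (P r (suc k)) ++ map insert0 (P r k)))
      ≡⟨ cong sumL (map-++ xb (map (map suc) (P r (suc k))) (map insert0 (P r k))) ⟩
    sumL (map xb (map (map suc) (P r (suc k))) ++ map xb (map insert0 (P r k)))
      ≈⟨ sumL-++ (map xb (map (map suc) (P r (suc k)))) (map xb (map insert0 (P r k))) ⟩
    sumL (map xb (map (map suc) (P r (suc k)))) + sumL (map xb (map insert0 (P r k)))
      ≡⟨ ≡.cong₂ (λ l l′ → sumL l + sumL l′)
                (≡.trans (≡.sym (map-∘ (P r (suc k)))) (map-cong (xFrom-map x suc b) (P r (suc k))))
                (≡.trans (≡.sym (map-∘ (P r k))) (map-cong (λ U → cong (c₀ *_) (xFrom-map x suc (suc b) U)) (P r k))) ⟩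
    subsetSum b (x ∘ suc) (suc k) + sumL (map (λ U → c₀ * xFrom (x ∘ suc) (suc b) U) (P r k))
      ≈⟨ +-congˡ (sumL-map-*ˡ c₀ (xFrom (x ∘ suc) (suc b)) (P r k)) ⟩
    subsetSum b (x ∘ suc) (suc k) + c₀ * subsetSum (suc b) (x ∘ suc) k ∎
    where
    xb : List (Fin (suc r)) → C
    xb = xFrom x b
    insert0 : List (Fin r) → List (Fin (suc r))
    insert0 U = zero ∷ map suc U
    c₀ : C
    c₀ = x zero - nat b

  conv-subsetSum-suc : ∀ {r} y b (x : Fin (suc r) → C) →
    conv (fall y) (subsetSum b x) (suc r) ≈
      y * conv (fall (y - 1#)) (subsetSum b (x ∘ suc)) r
        + (x zero - nat b) * conv (fall y) (subsetSum (suc b) (x ∘ suc)) r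
  conv-subsetSum-suc {r} y b x = begin
    conv (fall y) (subsetSum b x) (suc r)
      ≈⟨ conv-cong {f = fall y} (λ _ → refl) (subsetSum-split b x) (suc r) ⟩
    conv (fall y) (λ k → E′ k + c₀ * shift E″ k) (suc r)
      ≈⟨ conv-+ʳ (fall y) E′ (λ k → c₀ * shift E″ k) (suc r) ⟩
    conv (fall y) E′ (suc r) + conv (fall y) (λ k → c₀ * shift E″ k) (suc r)
      ≈⟨ +-cong y-part (trans (conv-*ʳ c₀ (fall y) (shift E″) (suc r)) (*-congˡ (conv-shift (fall y) E″ r))) ⟩
    y * conv (fall (y - 1#)) E′ r + c₀ * conv (fall y) E″ r ∎
    where
    c₀ : C
    c₀ = x zero - nat b
    E′ E″ : ℕ → C
    E′ = subsetSum b (x ∘ suc)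
    E″ = subsetSum (suc b) (x ∘ suc)
    y-part : conv (fall y) E′ (suc r) ≈ y * conv (fall (y - 1#)) E′ r
    y-part = begin
      conv (fall y) E′ (suc r)                          ≡⟨ conv-suc (fall y) E′ r ⟩
      fall y 0 * E′ (suc r) + conv (fall y ∘ suc) E′ r  ≈⟨ +-congʳ (trans (*-congˡ (subsetSum-empty b (x ∘ suc))) (zeroʳ _)) ⟩
      0# + conv (fall y ∘ suc) E′ r                     ≈⟨ +-identityˡ _ ⟩
      conv (fall y ∘ suc) E′ r                          ≈⟨ conv-cong {g = E′} (fall-suc y) (λ _ → refl) r ⟩
      conv (λ i → y * fall (y - 1#) i) E′ r             ≈⟨ conv-*ˡ y (fall (y - 1#)) E′ r ⟩
      y * conv (fall (y - 1#)) E′ r                     ∎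

  expansion : ∀ r y b (x : Fin r → C) →
    prodL (tabulate (λ i → (y + x i) - nat (b +ℕ toℕ i))) ≈ conv (fall y) (subsetSum b x) r
  expansion zero y b x = sym (trans (+-identityʳ _) (trans (*-identityˡ _) (+-identityʳ 1#)))
  expansion (suc r) y b x = begin
    ((y + x zero) - nat (b +ℕ 0)) * rest
      ≈⟨ *-congʳ (trans (reflexive (cong (λ n → (y + x zero) - nat n) (+ℕ-identityʳ b))) (+-assoc y _ _)) ⟩
    (y + c₀) * rest
      ≈⟨ distribʳ rest y c₀ ⟩
    y * rest + c₀ * rest
      ≈⟨ +-cong (*-congˡ (trans (prodL-tabulate-cong y-choice) (expansion r (y - 1#) b (x ∘ suc))))
                (*-congˡ (trans (prodL-tabulate-cong x-choice) (expansion r y (suc b) (x ∘ suc)))) ⟩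
    y * conv (fall (y - 1#)) (subsetSum b (x ∘ suc)) r + c₀ * conv (fall y) (subsetSum (suc b) (x ∘ suc)) r
      ≈⟨ sym (conv-subsetSum-suc y b x) ⟩
    conv (fall y) (subsetSum b x) (suc r) ∎
    where
    c₀ rest : C
    c₀ = x zero - nat b
    rest = prodL (tabulate (λ i → (y + x (suc i)) - nat (b +ℕ suc (toℕ i))))
    offset-suc : ∀ i → nat (b +ℕ suc (toℕ i)) ≡ nat (suc b +ℕ toℕ i)
    offset-suc i = cong nat (+-suc b (toℕ i))
    y-choice : ∀ i → (y + x (suc i)) - nat (b +ℕ suc (toℕ i)) ≈ ((y - 1#) + x (suc i)) - nat (b +ℕ toℕ i)
    y-choice i = begin
      (y + x (suc i)) - nat (b +ℕ suc (toℕ i))         ≡⟨ cong (λ m → (y + x (suc i)) - m) (offset-suc i) ⟩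
      (y + x (suc i)) + (- (1# + nat (b +ℕ toℕ i)))    ≈⟨ +-congˡ (sym (-‿+-comm 1# _)) ⟩
      (y + x (suc i)) + (- 1# + - nat (b +ℕ toℕ i))    ≈⟨ interchange y _ _ _ ⟩
      (y - 1#) + (x (suc i) - nat (b +ℕ toℕ i))        ≈⟨ sym (+-assoc _ _ _) ⟩
      ((y - 1#) + x (suc i)) - nat (b +ℕ toℕ i)        ∎
    x-choice : ∀ i → (y + x (suc i)) - nat (b +ℕ suc (toℕ i)) ≈ (y + x (suc i)) - nat (suc b +ℕ toℕ i)
    x-choice i = reflexive (cong (λ m → (y + x (suc i)) - m) (offset-suc i))

lemma20 : {c ℓ : Level} (R : CommutativeRing c ℓ) (r : ℕ)
    (y : CommutativeRing.Carrier R) (x : Fin r → CommutativeRing.Carrier R) →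
    CommutativeRing._≈_ R (Ops.lhs R r y x) (Ops.rhs R r y x)
lemma20 R r y x = begin
  prodL (map h (allFin r)) ≡⟨ cong prodL (map-tabulate id h) ⟩
  prodL (tabulate h)       ≈⟨ expansion r y 0 x ⟩
  Ops.rhs R r y x          ∎
  where
  open CommutativeRing R
  open Ops R
  open Expansion R
  open import Relation.Binary.Reasoning.Setoid setoid
  h : Fin r → Carrier
  h i = (y + x i) - nat (toℕ i)
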